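{- Let $\prec$ be a well-founded strict order on a set $\mathcal{S}$ of propositions and let $\mathcal{A}$ be an automaton with respect to $\prec$. Then any complement $\mathcal{B}$ of $\mathcal{A}$ is an automaton (with respect to $\prec$) as well.
   Context: An inference rule is a partial function $f:\mathcal{S}^n\rightharpoonup\mathcal{S}$ for some $n\ge0$; $B$ is derivable from $\langle A_1,\dots,A_n\rangle$ with $f$ if $f(A_1,\dots,A_n)$ is defined and equals $B$. An inference system is a set of rules; it is finite in conclusions if each proposition is derivable with a rule of the system from only finitely many sequences. A rule $r$ is an introduction rule (w.r.t. $\prec$) if whenever $B$ is derivable from $\langle A_1,\dots,A_n\rangle$ with $r$, $A_i\prec B$ for all $i$. An automaton is an inference system finite in conclusions containing introduction rules only. A system $\mathcal{B}$ is a complement of a system $\mathcal{A}$ finite in conclusions if $\mathcal{B}$ is finite in conclusions and for every $B$, if $\langle A^1_1,\dots,A^1_{n_1}\rangle,\dots,\langle A^p_1,\dots,A^p_{n_p}\rangle$ are all sequences from which $B$ is derivable with a rule of $\mathcal{A}$, then the sequences from which $B$ is derivable with a rule of $\mathcal{B}$ are exactly the $\langle A^1_{j_1},\dots,A^p_{j_p}\rangle$ with $1\le j_i\le n_i$. -}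

module Defs where

open import Level using (0ℓ)
open import Data.Nat using (ℕ)
open import Data.Fin using (Fin)
open import Data.Vec using (Vec; lookup; fromList)
open import Data.List using (List; length)
open import Data.List.Membership.Propositional using (_∈_)
open import Data.List.Relation.Unary.Unique.Propositional using (Unique)
open import Data.List.Relation.Binary.Pointwise using (Pointwise)
open import Data.Product using (Σ; ∃; _×_)
open import Function.Bundles using (_⇔_)
open import Relation.Binary.PropositionalEquality using (_≡_; subst; sym)

module _ {S : Set} where

  -- An inference rule: a partial function S^n ⇀ S, given by its graph
  -- (a functional relation).
  record Rule : Set₁ where
    field
      arity      : ℕ
      graph      : Vec S arity → S → Set
      functional : ∀ {as b c} → graph as b → graph as c → b ≡ c
  open Rule public

  System : Set₁
  System = Rule → Set

  DerivableWith : Rule → List S → S → Set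
  DerivableWith r as B =
    Σ (arity r ≡ length as) λ e → graph r (subst (Vec S) (sym e) (fromList as)) B

  Derivable : System → List S → S → Set₁
  Derivable 𝒜 as B = Σ Rule λ r → 𝒜 r × DerivableWith r as B

  FiniteInConclusions : System → Set₁
  FiniteInConclusions 𝒜 =
    ∀ B → ∃ λ (L : List (List S)) → ∀ as → (as ∈ L) ⇔ Derivable 𝒜 as B

  IsIntroduction : (S → S → Set) → Rule → Set
  IsIntroduction _≺_ r = ∀ as B → graph r as B → ∀ (i : Fin (arity r)) → lookup as i ≺ B

  IsAutomaton : (S → S → Set) → System → Set₁
  IsAutomaton _≺_ 𝒜 = FiniteInConclusions 𝒜 × (∀ r → 𝒜 r → IsIntroduction _≺_ r)

  IsComplement : System → System → Set₁
  IsComplement ℬ 𝒜 =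
    FiniteInConclusions ℬ ×
    (∀ B → ∃ λ (L : List (List S)) →
        Unique L ×
        (∀ as → (as ∈ L) ⇔ Derivable 𝒜 as B) ×
        (∀ cs → Derivable ℬ cs B ⇔ Pointwise (λ Li c → c ∈ Li) L cs))

-- A ℬ-derivation of B takes its premises one from each 𝒜-derivation of B,
-- so every such premise is a premise of an introduction rule with conclusion
-- B and hence lies below B.
module Submission where

open import Defs
open import Relation.Binary.PropositionalEquality using (_≡_; refl; sym; trans; subst)
open import Relation.Binary.Structures using (IsStrictPartialOrder)
open import Induction.WellFounded using (WellFounded)
open import Data.Nat using (ℕ)
open import Data.Vec using (Vec; fromList; toList)
open import Data.Vec.Properties using (length-toList; fromList∘toList; subst-is-cast)
import Data.Vec.Relation.Unary.All as Vec
import Data.Vec.Relation.Unary.All.Properties as Vec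
open import Data.List using (List; length)
open import Data.List.Relation.Unary.All as All using (All; []; _∷_)
open import Data.List.Relation.Binary.Pointwise using (Pointwise; []; _∷_)
open import Data.List.Membership.Propositional using (_∈_)
open import Data.Product using (_,_)
open import Function.Bundles using (Equivalence)

module _ {S : Set} where

  All-choice : ∀ {P : S → Set} {L : List (List S)} {cs : List S} →
    Pointwise (λ Li c → c ∈ Li) L cs → All (All P) L → All P cs
  All-choice []         []           = []
  All-choice (c∈ ∷ c∈s) (Pᴸ ∷ Pᴸˢ) = All.lookup Pᴸ c∈ ∷ All-choice c∈s Pᴸˢ

  All-subst-fromList⁻ : ∀ {P : S → Set} {as : List S} {n : ℕ} (e : length as ≡ n) →
    Vec.All P (subst (Vec S) e (fromList as)) → All P as
  All-subst-fromList⁻ refl = Vec.fromList⁻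

  derivableWith-toList : ∀ {r : Rule} {as : Vec S (arity r)} {B : S} →
    graph r as B → DerivableWith r (toList as) B
  derivableWith-toList {r} {as} {B} g =
    sym (length-toList as) , subst (λ v → graph r v B) (sym fromList-toList) g
    where
    fromList-toList : subst (Vec S) (sym (sym (length-toList as))) (fromList (toList as)) ≡ as
    fromList-toList = trans (subst-is-cast _ _) (fromList∘toList as)

  module _ (_≺_ : S → S → Set) where

    PremisesBelow : Rule → Set
    PremisesBelow r = ∀ {as B} → DerivableWith r as B → All (_≺ B) as

    introduction⇒premisesBelow : ∀ {r} → IsIntroduction _≺_ r → PremisesBelow r
    introduction⇒premisesBelow intro {B = B} (e , g) =
      All-subst-fromList⁻ (sym e) (Vec.lookup⁻ (intro _ B g))

    premisesBelow⇒introduction : ∀ {r} → PremisesBelow r → IsIntroduction _≺_ r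
    premisesBelow⇒introduction {r} below as B g =
      Vec.lookup⁺ (Vec.toList⁻ (below (derivableWith-toList {r} {as} g)))

    complement-premisesBelow : ∀ {𝒜 ℬ : System {S}} →
      (∀ r → 𝒜 r → IsIntroduction _≺_ r) → IsComplement ℬ 𝒜 →
      ∀ r → ℬ r → PremisesBelow r
    complement-premisesBelow intro (_ , complement) r r∈ℬ {cs} {B} d
      with complement B
    ... | L , _ , L⇔𝒜 , ℬ⇔choice =
      All-choice (Equivalence.to (ℬ⇔choice cs) (r , r∈ℬ , d))
                 (All.tabulate 𝒜-premisesBelow)
      where
      𝒜-premisesBelow : ∀ {as} → as ∈ L → All (_≺ B) as
      𝒜-premisesBelow {as} as∈L with Equivalence.to (L⇔𝒜 as) as∈L
      ... | r′ , r′∈𝒜 , d′ = introduction⇒premisesBelow {r′} (intro r′ r′∈𝒜) d′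

proposition3 : {S : Set} (_≺_ : S → S → Set) →
    IsStrictPartialOrder _≡_ _≺_ → WellFounded _≺_ →
    (𝒜 ℬ : System {S}) → IsAutomaton _≺_ 𝒜 → IsComplement ℬ 𝒜 →
    IsAutomaton _≺_ ℬ
proposition3 _≺_ _ _ 𝒜 ℬ (_ , intro) complement@(finite , _) =
  finite , λ r r∈ℬ →
    premisesBelow⇒introduction _≺_ {r}
      (complement-premisesBelow _≺_ {𝒜} intro complement r r∈ℬ)
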